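{- Let $p$ be a prime, $n\ge1$, $F=\mathbb{F}_{p^n}$ and $f\colon F\to F$ any function. Then $\tilde B_f(x,a)=\tilde D_af(x)-\tilde D_af(0)$ for all $x,a\in F$.
   Context: $\tilde D_af(x)=\sum_{j\in\mathbb{F}_p}f(x+ja)$. For $m\ge1$, $[f]^m(x_1,\dots,x_m)=\sum_{I\subseteq\{1,\dots,m\}}(-1)^{m-|I|}f\big(\sum_{k\in I}x_k\big)$ (empty sum $=0$), and $\tilde B_f(x,y)=[f]^p(x,y,\dots,y)$ with $y$ repeated $p-1$ times. -}

module Defs where

open import Level using (0ℓ)
open import Data.Nat using (ℕ; zero; suc; _∸_; _^_)
open import Data.Fin using (Fin)
import Data.Fin as Fin
open import Data.Fin.Subset using (Subset; inside; outside; ∣_∣)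
open import Data.Vec using (Vec; []; _∷_; lookup)
open import Data.List using (List; []; _∷_; map; foldr; _++_; allFin)
open import Data.Product using (Σ; _×_)
open import Relation.Binary.PropositionalEquality using (_≡_)
open import Relation.Nullary using (¬_)
open import Algebra.Structures using (IsCommutativeRing)
open import Function.Bundles using (_↔_)

record FiniteField (q : ℕ) : Set₁ where
  infixl 6 _+_ _-_
  infixl 7 _*_
  field
    Carrier : Set
    _+_ _*_ : Carrier → Carrier → Carrier
    -_      : Carrier → Carrier
    0# 1#   : Carrier
    isCommutativeRing : IsCommutativeRing _≡_ _+_ _*_ -_ 0# 1#
    0≢1     : ¬ (0# ≡ 1#)
    inverse : ∀ x → ¬ (x ≡ 0#) → Σ Carrier (λ y → x * y ≡ 1#)
    enum    : Carrier ↔ Fin q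

  _-_ : Carrier → Carrier → Carrier
  x - y = x + (- y)

GF : ℕ → ℕ → Set₁
GF p n = FiniteField (p ^ n)

allSubsets : (m : ℕ) → List (Subset m)
allSubsets zero    = [] ∷ []
allSubsets (suc m) = map (inside ∷_) (allSubsets m) ++ map (outside ∷_) (allSubsets m)

module FieldOps {q : ℕ} (F : FiniteField q) where
  open FiniteField F

  sumL : List Carrier → Carrier
  sumL = foldr _+_ 0#

  -- natural-number multiple j·a = a + … + a (j times); for j < p this is
  -- the product of the prime-field element j with a.
  _·_ : ℕ → Carrier → Carrier
  zero  · a = 0#
  suc j · a = a + j · a

  sign : ℕ → Carrier
  sign zero    = 1#
  sign (suc k) = - sign k

  subsetSum : {m : ℕ} → Subset m → (Fin m → Carrier) → Carrier
  subsetSum {m} I x = sumL (map (λ k → sel (lookup I k) (x k)) (allFin m))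
    where
    open import Data.Bool using (Bool; true; false)
    sel : Bool → Carrier → Carrier
    sel true  y = y
    sel false _ = 0#

  D̃ : (p : ℕ) → (Carrier → Carrier) → Carrier → Carrier → Carrier
  D̃ p f a x = sumL (map (λ j → f (x + Data.Fin.toℕ j · a)) (allFin p))

  bracket : (m : ℕ) → (Carrier → Carrier) → (Fin m → Carrier) → Carrier
  bracket m f x = sumL (map (λ I → sign (m ∸ ∣ I ∣) * f (subsetSum I x)) (allSubsets m))

  B̃ : (p : ℕ) → (Carrier → Carrier) → Carrier → Carrier → Carrier
  B̃ zero    f x y = bracket zero f (λ ())
  B̃ (suc p) f x y = bracket (suc p) f xs
    where
    xs : Fin (suc p) → Carrier
    xs Fin.zero    = x
    xs (Fin.suc _) = y

module Submission where

-- Write Δ_c^m h(0) = [h]^m(c,…,c) for the m-th iterated forward difference with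
-- step c.  Splitting the subsets of {1,…,p} according to whether they contain the
-- first index gives  [f]^p(x,a,…,a) = Δ_a^{p-1} f(x+·)(0) − Δ_a^{p-1} f(0+·)(0).
-- The recursion Δ^{m+1}h = Δ^m h(c+·) − Δ^m h yields the binomial expansion
-- Δ_c^m h(0) = Σ_{j≤m} (−1)^{m+j} C(m,j) h(jc).  Finally F has characteristic p
-- (Σ_{x∈F} x = Σ_{x∈F} (x+1) forces |F|·1 = 0, and F has no zero divisors), and
-- p ∣ C(p,j) for 0<j<p turns Pascal's rule into C(p−1,j) ≡ (−1)^j, so every
-- coefficient of Δ^{p-1} is 1 and Δ_a^{p-1} h(0) = Σ_{j<p} h(ja) = D̃_a.

open import Defs
open import Data.Nat using (ℕ; _≥_)
open import Data.Nat.Primality using (Prime)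
open import Relation.Binary.PropositionalEquality using (_≡_)

open import Level using (0ℓ)
open import Data.Nat as ℕ using (zero; suc; _∸_; _^_; _<_; _≤_; s≤s; z≤n)
import Data.Nat.Properties as ℕ
open import Data.Nat.Combinatorics using (_C_; nCk+nC[k+1]≡[n+1]C[k+1]; k>n⇒nCk≡0; nCn≡1; nC1≡n)
open import Data.Nat.Divisibility using (_∣_; divides; ∣⇒≤)
open import Data.Nat.Primality using (euclidsLemma; prime⇒nonZero)
open import Data.Fin as Fin using (Fin; toℕ)
open import Data.Fin.Properties using (toℕ-inject₁; toℕ-fromℕ; toℕ<n)
open import Data.Fin.Subset using (Subset; inside; outside; ∣_∣)
open import Data.Fin.Subset.Properties using (∣p∣≤n)
open import Data.Fin.Permutation using (Permutation)
open import Data.Vec using (_∷_)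
open import Data.List using (List; []; _∷_; map; _++_; allFin; tabulate)
import Data.List.Properties as List
open import Data.Product using (_,_)
open import Data.Sum using (inj₁; inj₂)
open import Data.Empty using (⊥-elim)
open import Relation.Nullary using (¬_; Dec; yes; no)
open import Relation.Nullary.Decidable using (via-injection)
open import Relation.Binary.PropositionalEquality
  using (refl; sym; trans; cong; cong₂; subst; module ≡-Reasoning)
open import Function.Bundles using (Inverse; _↔_; mk↔ₛ′)
open import Function.Properties.Inverse using (↔⇒↣)
open import Function.Construct.Composition using (_↔-∘_)
open import Function.Construct.Symmetry using (↔-sym)
open import Algebra.Bundles using (CommutativeRing)

absorption : ∀ n k → suc k ℕ.* (suc n C suc k) ≡ suc n ℕ.* (n C k)
absorption zero    zero    = refl
absorption zero    (suc k) = ℕ.*-zeroʳ (suc (suc k))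
absorption (suc n) zero    = begin
  1 ℕ.* (suc (suc n) C 1)  ≡⟨ ℕ.*-identityˡ _ ⟩
  suc (suc n) C 1          ≡⟨ nC1≡n (suc (suc n)) ⟩
  suc (suc n)              ≡⟨ ℕ.*-identityʳ _ ⟨
  suc (suc n) ℕ.* 1        ∎
  where open ≡-Reasoning
absorption (suc n) (suc k) = begin
  suc (suc k) ℕ.* (suc (suc n) C suc (suc k))
    ≡⟨ cong (suc (suc k) ℕ.*_) (nCk+nC[k+1]≡[n+1]C[k+1] (suc n) (suc k)) ⟨
  suc (suc k) ℕ.* (A ℕ.+ B)
    ≡⟨ ℕ.*-distribˡ-+ (suc (suc k)) A B ⟩
  (A ℕ.+ suc k ℕ.* A) ℕ.+ suc (suc k) ℕ.* B
    ≡⟨ cong₂ (λ u v → (A ℕ.+ u) ℕ.+ v) (absorption n k) (absorption n (suc k)) ⟩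
  (A ℕ.+ suc n ℕ.* (n C k)) ℕ.+ suc n ℕ.* (n C suc k)
    ≡⟨ ℕ.+-assoc A _ _ ⟩
  A ℕ.+ (suc n ℕ.* (n C k) ℕ.+ suc n ℕ.* (n C suc k))
    ≡⟨ cong (A ℕ.+_) (ℕ.*-distribˡ-+ (suc n) (n C k) (n C suc k)) ⟨
  A ℕ.+ suc n ℕ.* (n C k ℕ.+ n C suc k)
    ≡⟨ cong (λ z → A ℕ.+ suc n ℕ.* z) (nCk+nC[k+1]≡[n+1]C[k+1] n k) ⟩
  A ℕ.+ suc n ℕ.* A ∎
  where
  open ≡-Reasoning
  A = suc n C suc k
  B = suc n C suc (suc k)

-- p divides C(p,k) for 0 < k < p: by absorption p ∣ k·C(p,k), and p ∤ k.
prime∣pCk : ∀ {p k} → Prime p → 0 < k → k < p → p ∣ p C k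
prime∣pCk {suc n} {suc k} p-prime _ k<p
  with euclidsLemma (suc k) (suc n C suc k) p-prime
         (divides (n C k) (trans (absorption n k) (ℕ.*-comm (suc n) (n C k))))
... | inj₁ p∣k+1 = ⊥-elim (ℕ.<⇒≱ k<p (∣⇒≤ p∣k+1))
... | inj₂ p∣C   = p∣C

module FiniteFieldFacts {q : ℕ} (F : FiniteField q) where
  open FiniteField F
  open FieldOps F
  open ≡-Reasoning

  commutativeRing : CommutativeRing 0ℓ 0ℓ
  commutativeRing = record { isCommutativeRing = isCommutativeRing }

  open CommutativeRing commutativeRing
    using ( +-identityˡ; +-identityʳ; +-assoc; +-comm; -‿inverseˡ; -‿inverseʳ
          ; *-identityˡ; *-assoc; *-comm; zeroˡ; zeroʳ; distribˡ; distribʳ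
          ; ring; semiring )
  open import Algebra.Properties.Ring ring
    using ( -‿distribˡ-*; -‿involutive; -‿+-comm; -0#≈0#
          ; +-identityʳ-unique; +-inverseʳ-unique )
  open import Algebra.Properties.Semiring.Sum semiring
    using (sum; sum-syntax; sum-cong-≗; ∑-distrib-+; sum-init-last; sum-permute; sum-replicate)
  open import Algebra.Properties.Semiring.Mult semiring
    using (_×_; ×-homo-+; ×1-homo-*)

  neg-swap : ∀ x A B → - x + (A - B) ≡ A - (x + B)
  neg-swap x A B = begin
    - x + (A + - B)   ≡⟨ +-assoc (- x) A (- B) ⟨
    (- x + A) + - B   ≡⟨ cong (_+ - B) (+-comm (- x) A) ⟩
    (A + - x) + - B   ≡⟨ +-assoc A (- x) (- B) ⟩
    A + (- x + - B)   ≡⟨ cong (A +_) (-‿+-comm x B) ⟩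
    A + - (x + B)     ∎

  neg-mul-neg : ∀ x y → (- x) * (- y) ≡ x * y
  neg-mul-neg x y = begin
    (- x) * (- y)   ≡⟨ -‿distribˡ-* x (- y) ⟨
    - (x * - y)     ≡⟨ cong -_ (*-comm x (- y)) ⟩
    - ((- y) * x)   ≡⟨ cong -_ (-‿distribˡ-* y x) ⟨
    - - (y * x)     ≡⟨ -‿involutive (y * x) ⟩
    y * x           ≡⟨ *-comm y x ⟩
    x * y           ∎

  sign-+ : ∀ m n → sign (m ℕ.+ n) ≡ sign m * sign n
  sign-+ zero    n = sym (*-identityˡ (sign n))
  sign-+ (suc m) n = trans (cong -_ (sign-+ m n)) (-‿distribˡ-* (sign m) (sign n))

  sign-square : ∀ m → sign m * sign m ≡ 1#
  sign-square zero    = *-identityˡ 1#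
  sign-square (suc m) = trans (neg-mul-neg (sign m) (sign m)) (sign-square m)

  ·≗× : ∀ n x → n · x ≡ n × x
  ·≗× zero    x = refl
  ·≗× (suc n) x = cong (x +_) (·≗× n x)

  sumL-++ : ∀ xs ys → sumL (xs ++ ys) ≡ sumL xs + sumL ys
  sumL-++ []       ys = sym (+-identityˡ (sumL ys))
  sumL-++ (x ∷ xs) ys = trans (cong (x +_) (sumL-++ xs ys)) (sym (+-assoc x (sumL xs) (sumL ys)))

  sumL-neg : ∀ {A : Set} (g : A → Carrier) xs → sumL (map (λ z → - g z) xs) ≡ - sumL (map g xs)
  sumL-neg g []       = sym -0#≈0#
  sumL-neg g (x ∷ xs) = trans (cong (- g x +_) (sumL-neg g xs)) (-‿+-comm (g x) (sumL (map g xs)))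

  sumL-allFin : ∀ n (g : Fin n → Carrier) → sumL (map g (allFin n)) ≡ sum g
  sumL-allFin zero    g = refl
  sumL-allFin (suc n) g = begin
    sumL (map g (allFin (suc n)))                 ≡⟨ cong sumL (List.map-tabulate (λ i → i) g) ⟩
    g Fin.zero + sumL (tabulate (λ i → g (Fin.suc i)))
      ≡⟨ cong (λ l → g Fin.zero + sumL l) (List.map-tabulate (λ i → i) (λ i → g (Fin.suc i))) ⟨
    g Fin.zero + sumL (map (λ i → g (Fin.suc i)) (allFin n))
      ≡⟨ cong (g Fin.zero +_) (sumL-allFin n (λ i → g (Fin.suc i))) ⟩
    sum g ∎

  ∑-neg : ∀ n (g : Fin n → Carrier) → ∑[ i < n ] (- g i) ≡ - sum g
  ∑-neg n g = trans (sym (sumL-allFin n _)) (trans (sumL-neg g (allFin n)) (cong -_ (sumL-allFin n g)))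

  ∑-distrib-− : ∀ n (g k : Fin n → Carrier) → ∑[ i < n ] (g i - k i) ≡ sum g - sum k
  ∑-distrib-− n g k = trans (∑-distrib-+ g (λ i → - k i)) (cong (sum g +_) (∑-neg n k))

  ∑-drop-last : ∀ m (g : ℕ → Carrier) → g m ≡ 0# → ∑[ j < suc m ] g (toℕ j) ≡ ∑[ j < m ] g (toℕ j)
  ∑-drop-last m g gm≡0 = begin
    ∑[ j < suc m ] g (toℕ j)                                ≡⟨ sum-init-last {m} (λ j → g (toℕ j)) ⟩
    (∑[ j < m ] g (toℕ (Fin.inject₁ j))) + g (toℕ (Fin.fromℕ m))
      ≡⟨ cong₂ _+_ (sum-cong-≗ {m} (λ j → cong g (toℕ-inject₁ j))) (trans (cong g (toℕ-fromℕ m)) gm≡0) ⟩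
    (∑[ j < m ] g (toℕ j)) + 0#                             ≡⟨ +-identityʳ _ ⟩
    ∑[ j < m ] g (toℕ j)                                    ∎

  subsetSum-inside : ∀ {m} (I : Subset m) (xs : Fin (suc m) → Carrier) →
    subsetSum (inside ∷ I) xs ≡ xs Fin.zero + subsetSum I (λ k → xs (Fin.suc k))
  subsetSum-inside {m} I xs =
    trans (sumL-allFin (suc m) _) (cong (xs Fin.zero +_) (sym (sumL-allFin m _)))

  subsetSum-outside : ∀ {m} (I : Subset m) (xs : Fin (suc m) → Carrier) →
    subsetSum (outside ∷ I) xs ≡ 0# + subsetSum I (λ k → xs (Fin.suc k))
  subsetSum-outside {m} I xs =
    trans (sumL-allFin (suc m) _) (cong (0# +_) (sym (sumL-allFin m _)))

  sumL-allSubsets : ∀ m (G : Subset (suc m) → Carrier) →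
    sumL (map G (allSubsets (suc m)))
      ≡ sumL (map (λ I → G (inside ∷ I)) (allSubsets m)) + sumL (map (λ I → G (outside ∷ I)) (allSubsets m))
  sumL-allSubsets m G = begin
    sumL (map G (map (inside ∷_) S ++ map (outside ∷_) S))
      ≡⟨ cong sumL (List.map-++ G (map (inside ∷_) S) (map (outside ∷_) S)) ⟩
    sumL (map G (map (inside ∷_) S) ++ map G (map (outside ∷_) S))
      ≡⟨ sumL-++ (map G (map (inside ∷_) S)) (map G (map (outside ∷_) S)) ⟩
    sumL (map G (map (inside ∷_) S)) + sumL (map G (map (outside ∷_) S))
      ≡⟨ cong₂ _+_ (cong sumL (List.map-∘ S)) (cong sumL (List.map-∘ S)) ⟨
    sumL (map (λ I → G (inside ∷ I)) S) + sumL (map (λ I → G (outside ∷ I)) S) ∎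
    where
    S : List (Subset m)
    S = allSubsets m

  bracket-split : ∀ m f (xs : Fin (suc m) → Carrier) →
    bracket (suc m) f xs
      ≡ bracket m (λ y → f (xs Fin.zero + y)) (λ k → xs (Fin.suc k))
        - bracket m (λ y → f (0# + y)) (λ k → xs (Fin.suc k))
  bracket-split m f xs = trans (sumL-allSubsets m term)
    (cong₂ _+_ (cong sumL (List.map-cong with-first S))
               (trans (cong sumL (List.map-cong without-first S)) (sumL-neg term′ S)))
    where
    S : List (Subset m)
    S = allSubsets m
    ys : Fin m → Carrier
    ys k = xs (Fin.suc k)
    term : Subset (suc m) → Carrier
    term I = sign (suc m ∸ ∣ I ∣) * f (subsetSum I xs)
    term′ : Subset m → Carrier
    term′ I = sign (m ∸ ∣ I ∣) * f (0# + subsetSum I ys)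
    with-first : ∀ I → term (inside ∷ I) ≡ sign (m ∸ ∣ I ∣) * f (xs Fin.zero + subsetSum I ys)
    with-first I = cong (λ z → sign (m ∸ ∣ I ∣) * f z) (subsetSum-inside I xs)
    -- |I| ≤ m, so (-1)^{m+1-|I|} = -(-1)^{m-|I|}
    without-first : ∀ I → term (outside ∷ I) ≡ - term′ I
    without-first I = begin
      sign (suc m ∸ ∣ I ∣) * f (subsetSum (outside ∷ I) xs)
        ≡⟨ cong₂ _*_ (cong sign (ℕ.+-∸-assoc 1 (∣p∣≤n I))) (cong f (subsetSum-outside I xs)) ⟩
      (- sign (m ∸ ∣ I ∣)) * f (0# + subsetSum I ys)
        ≡⟨ -‿distribˡ-* (sign (m ∸ ∣ I ∣)) _ ⟨
      - term′ I ∎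

  bracket-cong : ∀ m {f g} (xs : Fin m → Carrier) → (∀ y → f y ≡ g y) → bracket m f xs ≡ bracket m g xs
  bracket-cong m xs f≗g =
    cong sumL (List.map-cong (λ I → cong (sign (m ∸ ∣ I ∣) *_) (f≗g (subsetSum I xs))) (allSubsets m))

  Δ : Carrier → ℕ → (Carrier → Carrier) → Carrier
  Δ c m h = bracket m h (λ _ → c)

  Δ-suc : ∀ c m h → Δ c (suc m) h ≡ Δ c m (λ y → h (c + y)) - Δ c m h
  Δ-suc c m h = trans (bracket-split m h (λ _ → c))
    (cong (λ z → Δ c m (λ y → h (c + y)) - z) (bracket-cong m (λ _ → c) (λ y → cong h (+-identityˡ y))))

  binomial : ℕ → ℕ → Carrier
  binomial m j = (m C j) × 1#

  -- (-1)^{m+j} C(m,j), the coefficient of X^j in (X - 1)^m.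
  coefficient : ℕ → ℕ → Carrier
  coefficient m j = sign (m ℕ.+ j) * binomial m j

  coefficient-zero : ∀ m → coefficient (suc m) 0 ≡ - coefficient m 0
  coefficient-zero m = sym (-‿distribˡ-* (sign (m ℕ.+ 0)) (binomial m 0))

  -- Pascal's rule for the coefficients: (X - 1)^{m+1} = X (X - 1)^m - (X - 1)^m.
  coefficient-pascal : ∀ m j → coefficient (suc m) (suc j) ≡ coefficient m j - coefficient m (suc j)
  coefficient-pascal m j = begin
    sign (suc m ℕ.+ suc j) * ((suc m C suc j) × 1#)
      ≡⟨ cong₂ (λ k n → sign k * (n × 1#)) (ℕ.+-suc (suc m) j) (sym (nCk+nC[k+1]≡[n+1]C[k+1] m j)) ⟩
    - - s * ((m C j ℕ.+ m C suc j) × 1#)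
      ≡⟨ cong₂ _*_ (-‿involutive s) (×-homo-+ 1# (m C j) (m C suc j)) ⟩
    s * (binomial m j + binomial m (suc j))
      ≡⟨ distribˡ s (binomial m j) (binomial m (suc j)) ⟩
    coefficient m j + s * binomial m (suc j)
      ≡⟨ cong (coefficient m j +_) next-term ⟩
    coefficient m j - coefficient m (suc j) ∎
    where
    s : Carrier
    s = sign (m ℕ.+ j)
    next-term : s * binomial m (suc j) ≡ - coefficient m (suc j)
    next-term = begin
      s * binomial m (suc j)          ≡⟨ -‿involutive _ ⟨
      - - (s * binomial m (suc j))    ≡⟨ cong -_ (-‿distribˡ-* s _) ⟩
      - ((- s) * binomial m (suc j))  ≡⟨ cong (λ k → - (sign k * binomial m (suc j))) (ℕ.+-suc m j) ⟨
      - coefficient m (suc j)         ∎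

  coefficient-vanishes : ∀ m → coefficient m (suc m) ≡ 0#
  coefficient-vanishes m =
    trans (cong (λ n → sign (m ℕ.+ suc m) * (n × 1#)) (k>n⇒nCk≡0 (ℕ.n<1+n m))) (zeroʳ _)

  Δ-expansion : ∀ c m h → Δ c m h ≡ ∑[ j < suc m ] (coefficient m (toℕ j) * h (toℕ j × c))
  Δ-expansion c zero    h = cong (λ z → z * h 0# + 0#) (sym (trans (*-identityˡ _) (+-identityʳ 1#)))
  Δ-expansion c (suc m) h = begin
    Δ c (suc m) h                        ≡⟨ Δ-suc c m h ⟩
    Δ c m (λ y → h (c + y)) - Δ c m h    ≡⟨ cong₂ _-_ (Δ-expansion c m (λ y → h (c + y))) (Δ-expansion c m h) ⟩
    A - (x + B)                          ≡⟨ neg-swap x A B ⟨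
    - x + (A - B)                        ≡⟨ cong₂ _+_ first-term shifted-terms ⟨
    ∑[ j < suc (suc m) ] (coefficient (suc m) (toℕ j) * H (toℕ j)) ∎
    where
    H : ℕ → Carrier
    H j = h (j × c)
    -- Δ^m h(c+·) = A, and Δ^m h = x + B (its j = 0 term split off)
    x A B : Carrier
    x = coefficient m 0 * H 0
    A = ∑[ j < suc m ] (coefficient m (toℕ j) * H (suc (toℕ j)))
    B = ∑[ j < m ] (coefficient m (suc (toℕ j)) * H (suc (toℕ j)))

    first-term : coefficient (suc m) 0 * H 0 ≡ - x
    first-term = trans (cong (_* H 0) (coefficient-zero m)) (sym (-‿distribˡ-* _ _))

    pascal-term : ∀ j → coefficient (suc m) (suc j) * H (suc j)
                        ≡ coefficient m j * H (suc j) - coefficient m (suc j) * H (suc j)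
    pascal-term j = begin
      coefficient (suc m) (suc j) * H (suc j)
        ≡⟨ cong (_* H (suc j)) (coefficient-pascal m j) ⟩
      (coefficient m j - coefficient m (suc j)) * H (suc j)
        ≡⟨ distribʳ (H (suc j)) _ _ ⟩
      coefficient m j * H (suc j) + (- coefficient m (suc j)) * H (suc j)
        ≡⟨ cong (coefficient m j * H (suc j) +_) (-‿distribˡ-* _ _) ⟨
      coefficient m j * H (suc j) - coefficient m (suc j) * H (suc j) ∎

    -- the last term of the subtracted sum is C(m, m+1) = 0
    shifted-terms : ∑[ j < suc m ] (coefficient (suc m) (suc (toℕ j)) * H (suc (toℕ j))) ≡ A - B
    shifted-terms = begin
      ∑[ j < suc m ] (coefficient (suc m) (suc (toℕ j)) * H (suc (toℕ j)))
        ≡⟨ sum-cong-≗ {suc m} (λ j → pascal-term (toℕ j)) ⟩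
      ∑[ j < suc m ] (coefficient m (toℕ j) * H (suc (toℕ j)) - coefficient m (suc (toℕ j)) * H (suc (toℕ j)))
        ≡⟨ ∑-distrib-− (suc m) (λ j → coefficient m (toℕ j) * H (suc (toℕ j)))
                               (λ j → coefficient m (suc (toℕ j)) * H (suc (toℕ j))) ⟩
      A - ∑[ j < suc m ] (coefficient m (suc (toℕ j)) * H (suc (toℕ j)))
        ≡⟨ cong (λ z → A - z) (∑-drop-last m (λ k → coefficient m (suc k) * H (suc k))
             (trans (cong (_* H (suc m)) (coefficient-vanishes m)) (zeroˡ _))) ⟩
      A - B ∎

  _≟_ : (x y : Carrier) → Dec (x ≡ y)
  _≟_ = via-injection (↔⇒↣ enum) Fin._≟_

  no-zero-divisors : ∀ x y → x * y ≡ 0# → ¬ (x ≡ 0#) → y ≡ 0#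
  no-zero-divisors x y xy≡0 x≢0 with inverse x x≢0
  ... | x⁻¹ , xx⁻¹≡1 = begin
    y              ≡⟨ *-identityˡ y ⟨
    1# * y         ≡⟨ cong (_* y) (trans (sym xx⁻¹≡1) (*-comm x x⁻¹)) ⟩
    (x⁻¹ * x) * y  ≡⟨ *-assoc x⁻¹ x y ⟩
    x⁻¹ * (x * y)  ≡⟨ cong (x⁻¹ *_) xy≡0 ⟩
    x⁻¹ * 0#       ≡⟨ zeroʳ x⁻¹ ⟩
    0#             ∎

  translation : Permutation q q
  translation = enum ↔-∘ (shift ↔-∘ ↔-sym enum)
    where
    cancel : ∀ a b → a + b ≡ 0# → ∀ y → (y + a) + b ≡ y
    cancel a b a+b≡0 y = trans (+-assoc y a b) (trans (cong (y +_) a+b≡0) (+-identityʳ y))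
    shift : Carrier ↔ Carrier
    shift = mk↔ₛ′ (_+ 1#) (_- 1#) (cancel (- 1#) 1# (-‿inverseˡ 1#)) (cancel 1# (- 1#) (-‿inverseʳ 1#))

  -- Σ_{x ∈ F} x = Σ_{x ∈ F} (x + 1) = Σ_{x ∈ F} x + q·1, so q·1 = 0.
  order-annihilates : q × 1# ≡ 0#
  order-annihilates = +-identityʳ-unique (sum element) (q × 1#) (sym (begin
    sum element                              ≡⟨ sum-permute element translation ⟩
    ∑[ i < q ] element (Inverse.to enum (element i + 1#))
      ≡⟨ sum-cong-≗ {q} (λ i → Inverse.strictlyInverseʳ enum (element i + 1#)) ⟩
    ∑[ i < q ] (element i + 1#)              ≡⟨ ∑-distrib-+ element (λ _ → 1#) ⟩
    sum element + ∑[ i < q ] 1#              ≡⟨ cong (sum element +_) (sum-replicate q) ⟩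
    sum element + q × 1#                     ∎))
    where
    element : Fin q → Carrier
    element = Inverse.from enum

  power-annihilates : ∀ p n → (p ^ suc n) × 1# ≡ 0# → p × 1# ≡ 0#
  power-annihilates p zero    p¹≡0 = trans (cong (_× 1#) (sym (ℕ.*-identityʳ p))) p¹≡0
  power-annihilates p (suc n) pⁿ⁺²≡0 with (p × 1#) ≟ 0#
  ... | yes p≡0 = p≡0
  ... | no  p≢0 = power-annihilates p n
        (no-zero-divisors (p × 1#) _ (trans (sym (×1-homo-* p (p ^ suc n))) pⁿ⁺²≡0) p≢0)

  characteristic : ∀ {p n} → n ≥ 1 → q ≡ p ^ n → p × 1# ≡ 0#
  characteristic {p} {suc n} _ q≡pⁿ = power-annihilates p n (subst (λ k → k × 1# ≡ 0#) q≡pⁿ order-annihilates)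

  multiple-annihilates : ∀ {p m} → p × 1# ≡ 0# → p ∣ m → m × 1# ≡ 0#
  multiple-annihilates {p} p≡0 (divides k refl) =
    trans (×1-homo-* k p) (trans (cong ((k × 1#) *_) p≡0) (zeroʳ (k × 1#)))

  D̃-as-sum : ∀ p f a x → D̃ p f a x ≡ ∑[ j < p ] f (x + toℕ j × a)
  D̃-as-sum p f a x = trans (sumL-allFin p _) (sum-cong-≗ {p} λ j → cong (λ y → f (x + y)) (·≗× (toℕ j) a))

  -- In characteristic p = N + 1 prime, C(p-1, j) ≡ (-1)^j, hence (X - 1)^{p-1} = Σ_{j<p} X^j
  -- and the iterated difference Δ^{p-1} becomes the plain sum over j < p.
  module PrimeCharacteristic (N : ℕ) (p-prime : Prime (suc N)) (char : suc N × 1# ≡ 0#) where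

    -- C(p-1, j+1) = -C(p-1, j) since their sum C(p, j+1) is divisible by p.
    binomial-top : ∀ j → j ≤ N → binomial N j ≡ sign j
    binomial-top zero    _      = +-identityʳ 1#
    binomial-top (suc j) j+1≤N = begin
      binomial N (suc j)  ≡⟨ +-inverseʳ-unique (binomial N j) (binomial N (suc j)) pascal-vanishes ⟩
      - binomial N j      ≡⟨ cong -_ (binomial-top j (ℕ.<⇒≤ j+1≤N)) ⟩
      - sign j            ∎
      where
      pascal-vanishes : binomial N j + binomial N (suc j) ≡ 0#
      pascal-vanishes = begin
        binomial N j + binomial N (suc j)   ≡⟨ ×-homo-+ 1# (N C j) (N C suc j) ⟨
        (N C j ℕ.+ N C suc j) × 1#          ≡⟨ cong (_× 1#) (nCk+nC[k+1]≡[n+1]C[k+1] N j) ⟩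
        (suc N C suc j) × 1#                ≡⟨ multiple-annihilates char (prime∣pCk p-prime (s≤s z≤n) (s≤s j+1≤N)) ⟩
        0#                                  ∎

    -- (-1)^N = C(N,N) = 1
    sign-top : sign N ≡ 1#
    sign-top = begin
      sign N        ≡⟨ binomial-top N ℕ.≤-refl ⟨
      (N C N) × 1#  ≡⟨ cong (_× 1#) (nCn≡1 N) ⟩
      1# + 0#       ≡⟨ +-identityʳ 1# ⟩
      1#            ∎

    -- every coefficient of (X - 1)^{p-1} is (-1)^{N+j}(-1)^j = 1
    coefficient-top : ∀ j → j ≤ N → coefficient N j ≡ 1#
    coefficient-top j j≤N = begin
      sign (N ℕ.+ j) * binomial N j   ≡⟨ cong₂ _*_ (sign-+ N j) (binomial-top j j≤N) ⟩
      (sign N * sign j) * sign j      ≡⟨ *-assoc (sign N) (sign j) (sign j) ⟩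
      sign N * (sign j * sign j)      ≡⟨ cong₂ _*_ sign-top (sign-square j) ⟩
      1# * 1#                         ≡⟨ *-identityˡ 1# ⟩
      1#                              ∎

    Δ-top : ∀ c h → Δ c N h ≡ ∑[ j < suc N ] h (toℕ j × c)
    Δ-top c h = trans (Δ-expansion c N h) (sum-cong-≗ {suc N} λ j →
      trans (cong (_* h (toℕ j × c)) (coefficient-top (toℕ j) (ℕ.s≤s⁻¹ (toℕ<n j)))) (*-identityˡ _))

    B̃≡D̃-D̃ : ∀ f x a → B̃ (suc N) f x a ≡ D̃ (suc N) f a x - D̃ (suc N) f a 0#
    B̃≡D̃-D̃ f x a = begin
      B̃ (suc N) f x a
        ≡⟨ bracket-split N f _ ⟩
      Δ a N (λ y → f (x + y)) - Δ a N (λ y → f (0# + y))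
        ≡⟨ cong₂ _-_ (Δ-top a (λ y → f (x + y))) (Δ-top a (λ y → f (0# + y))) ⟩
      (∑[ j < suc N ] f (x + toℕ j × a)) - (∑[ j < suc N ] f (0# + toℕ j × a))
        ≡⟨ cong₂ _-_ (D̃-as-sum (suc N) f a x) (D̃-as-sum (suc N) f a 0#) ⟨
      D̃ (suc N) f a x - D̃ (suc N) f a 0# ∎

open FiniteField using (Carrier; _-_; 0#)
open FieldOps using (B̃; D̃)
open FiniteFieldFacts using (characteristic; module PrimeCharacteristic)

proposition2p8 : (p n : ℕ) → Prime p → n ≥ 1 → (F : GF p n)
    → (f : Carrier F → Carrier F) → (x a : Carrier F)
    → B̃ F p f x a ≡ _-_ F (D̃ F p f a x) (D̃ F p f a (0# F))
proposition2p8 zero    n p-prime _   F = ⊥-elim (ℕ.NonZero.nonZero (prime⇒nonZero p-prime))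
proposition2p8 (suc N) n p-prime n≥1 F =
  PrimeCharacteristic.B̃≡D̃-D̃ F N p-prime (characteristic F n≥1 refl)
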